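{- Let $p$ be a prime, let $g=\sum_i a_i x^i\in\mathbb{Z}[x]$, $x_0\in\mathbb{Z}$ and $n\ge 1$. Let $c=\min_i v_p(a_i)$, $m=v_p(g'(x_0))$, $\lambda=\min\{m+n,\,c+2n\}$ and $k=v_p(g(x_0))$. Suppose $k<\lambda$. If either $k$ is odd, or $k$ is even and $g(x_0)/p^k$ is not a square modulo $p^{\lambda-k}$, then $g(x)$ is not a square in $\mathbb{Q}_p$ for every $x\in x_0+p^n\mathbb{Z}_p$. -}

module Defs where

open import Data.Nat using (ℕ; zero; suc; _^_; _⊓_) renaming (_+_ to _+ℕ_; _*_ to _*ℕ_)
open import Data.Integer using (ℤ; +_; _+_; _-_; _*_)
open import Data.Integer.Divisibility using (_∣_)
open import Data.List using (List; []; _∷_)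
open import Data.List.Relation.Unary.All using (All)
open import Data.List.Relation.Unary.Any using (Any)
open import Data.Maybe using (Maybe; just; nothing)
open import Data.Product using (Σ; ∃; _×_)
open import Relation.Nullary using (¬_)
open import Relation.Binary.PropositionalEquality using (_≡_)

-- A polynomial g = Σ_i a_i x^i ∈ ℤ[x] is its coefficient list a_0 ∷ a_1 ∷ ...
Poly : Set
Poly = List ℤ

eval : Poly → ℤ → ℤ
eval []       x = + 0
eval (a ∷ as) x = a + x * eval as x

derivFrom : ℕ → Poly → Poly
derivFrom i []       = []
derivFrom i (a ∷ as) = (+ i) * a ∷ derivFrom (suc i) as

deriv : Poly → Poly
deriv []       = []
deriv (a ∷ as) = derivFrom 1 as

-- v_p(a) = v  (a ≠ 0 forced by ¬ p^(v+1) ∣ a)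
ValP : ℕ → ℤ → ℕ → Set
ValP p a v = (+ (p ^ v) ∣ a) × ¬ (+ (p ^ suc v) ∣ a)

-- v_p(a) ∈ ℕ ∪ {∞}, with nothing = ∞ (i.e. a = 0)
Val∞ : ℕ → ℤ → Maybe ℕ → Set
Val∞ p a (just v) = ValP p a v
Val∞ p a nothing  = a ≡ + 0

MinCoeffVal : ℕ → Poly → ℕ → Set
MinCoeffVal p g c = All (λ a → + (p ^ c) ∣ a) g × Any (λ a → ValP p a c) g

_+∞_ : Maybe ℕ → ℕ → Maybe ℕ
just m  +∞ n = just (m +ℕ n)
nothing +∞ n = nothing

min∞ : Maybe ℕ → ℕ → ℕ
min∞ (just a) b = a ⊓ b
min∞ nothing  b = b

Odd : ℕ → Set
Odd k = ∃ λ h → k ≡ suc (2 *ℕ h)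

Even : ℕ → Set
Even k = ∃ λ h → k ≡ 2 *ℕ h

SquareMod : ℕ → ℕ → ℤ → Set
SquareMod p e u = ∃ λ t → + (p ^ e) ∣ (u - t * t)

-- p-adic integers ℤ_p as the inverse limit of ℤ/p^j:
-- sequences (x_j) with x_{j+1} ≡ x_j (mod p^j); x_j represents x mod p^j.
record ℤₚ (p : ℕ) : Set where
  field
    digit : ℕ → ℤ
    coh   : ∀ j → + (p ^ j) ∣ (digit (suc j) - digit j)
open ℤₚ public

InCoset : {p : ℕ} → ℤₚ p → ℤ → ℕ → Set
InCoset {p} x x0 n = + (p ^ n) ∣ (digit x n - x0)

-- the p-adic integer y (given by a coherent sequence y_j) is a square in ℚ_p:
-- since ℚ_p = ⋃_e p^(-e) ℤ_p, y = w² with w ∈ ℚ_p iff p^(2e) y = z² for some e, z ∈ ℤ_p.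
SquareInQp : (p : ℕ) → (ℕ → ℤ) → Set
SquareInQp p y = ∃ λ (e : ℕ) → Σ (ℤₚ p) λ z →
  ∀ j → + (p ^ j) ∣ ((+ (p ^ (2 *ℕ e))) * y j - digit z j * digit z j)

evalₚ : {p : ℕ} → Poly → ℤₚ p → ℕ → ℤ
evalₚ g x j = eval g (digit x j)

{-# OPTIONS --safe #-}
module Submission where

-- Write x_j = x0 + t with p^n ∣ t. As p^c divides every coefficient, Taylor's formula gives
-- g(x_j) ≡ g(x0) + t g'(x0) modulo p^c t², and p^(m+n) ∣ t g'(x0); hence g(x_j) ≡ g(x0) mod p^λ.
-- If p^(2e) g(x) = z² in ℤ_p, then z² ≡ p^(2e+k) u mod p^(2e+λ) where g(x0) = p^k u, p ∤ u.
-- Since λ > k, z² is p^(2e+k) times a unit congruent to u mod p^(λ−k); so 2e + k is even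
-- and u is a square modulo p^(λ−k).

open import Defs
open import Data.Nat using (ℕ; _^_; _≥_; _<_; _∸_) renaming (_+_ to _+ℕ_; _*_ to _*ℕ_)
open import Data.Nat.Primality using (Prime)
open import Data.Integer using (ℤ; +_; _*_)
open import Data.Maybe using (Maybe)
open import Data.Product using (_×_)
open import Data.Sum using (_⊎_)
open import Relation.Nullary using (¬_)
open import Relation.Binary.PropositionalEquality using (_≡_)

open import Data.Nat as ℕ using (zero; suc; _≤_; NonZero)
import Data.Nat.Properties as ℕ
open import Data.Nat.Primality using (euclidsLemma; prime⇒nonZero)
open import Data.Nat.Divisibility using () renaming (_∣_ to _∣ℕ_)
open import Data.Integer using (0ℤ; _+_; _-_; ∣_∣)
import Data.Integer.Properties as ℤ
open import Data.Integer.Divisibility.Signed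
open import Data.Integer.Tactic.RingSolver using (solve-∀)
open import Data.List using ([]; _∷_)
open import Data.List.Relation.Unary.All as All using (All; []; _∷_)
open import Data.Maybe using (just; nothing)
open import Data.Product using (Σ; ∃₂; _,_)
open import Data.Sum using (inj₁; inj₂; [_,_]′)
open import Data.Empty using (⊥-elim)
open import Relation.Binary.PropositionalEquality
  using (refl; sym; trans; cong; subst; module ≡-Reasoning)

_∣0 : ∀ d → d ∣ 0ℤ
d ∣0 = divides 0ℤ refl

∣-* : ∀ {a b c d} → a ∣ b → c ∣ d → a * c ∣ b * d
∣-* {b = b} {c = c} a∣b c∣d = ∣-trans (*-monoˡ-∣ c a∣b) (*-monoʳ-∣ b c∣d)

∣-≡ : ∀ {d a b} → a ≡ b → d ∣ b → d ∣ a
∣-≡ refl d∣b = d∣b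

telescope : ∀ a b c → a - c ≡ (a - b) + (b - c)
telescope = solve-∀

eval-derivFrom-suc : ∀ i as x →
  eval (derivFrom (suc i) as) x ≡ eval (derivFrom i as) x + eval as x
eval-derivFrom-suc i [] x = refl
eval-derivFrom-suc i (a ∷ as) x
  rewrite eval-derivFrom-suc (suc i) as x =
  identity (+ i) a x (eval (derivFrom (suc i) as) x) (eval as x)
  where
  identity : ∀ i a x E F → (+ 1 + i) * a + x * (E + F) ≡ (i * a + x * E) + (a + x * F)
  identity = solve-∀

eval-derivFrom-zero : ∀ as x → eval (derivFrom 0 as) x ≡ x * eval (deriv as) x
eval-derivFrom-zero [] x = sym (ℤ.*-zeroʳ x)
eval-derivFrom-zero (a ∷ as) x = identity a x (eval (derivFrom 1 as) x)
  where
  identity : ∀ a x E → + 0 * a + x * E ≡ x * E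
  identity = solve-∀

eval-deriv-∷ : ∀ a as x → eval (deriv (a ∷ as)) x ≡ eval as x + x * eval (deriv as) x
eval-deriv-∷ a as x = begin
  eval (derivFrom 1 as) x                  ≡⟨ eval-derivFrom-suc 0 as x ⟩
  eval (derivFrom 0 as) x + eval as x      ≡⟨ cong (_+ eval as x) (eval-derivFrom-zero as x) ⟩
  x * eval (deriv as) x + eval as x        ≡⟨ ℤ.+-comm _ (eval as x) ⟩
  eval as x + x * eval (deriv as) x        ∎
  where open ≡-Reasoning

∣-eval : ∀ {d} g x → All (d ∣_) g → d ∣ eval g x
∣-eval []       x []           = _ ∣0
∣-eval (a ∷ as) x (d∣a ∷ d∣as) = ∣m∣n⇒∣m+n d∣a (∣n⇒∣m*n x (∣-eval as x d∣as))

∣-eval-difference : ∀ {d} g b t → All (d ∣_) g → d * t ∣ eval g (b + t) - eval g b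
∣-eval-difference []       b t []           = _ ∣0
∣-eval-difference (a ∷ as) b t (d∣a ∷ d∣as) =
  ∣-≡ (identity a b t (eval as (b + t)) (eval as b))
    (∣m∣n⇒∣m+n (∣n⇒∣m*n b (∣-eval-difference as b t d∣as))
               (∣-* (∣-eval as (b + t) d∣as) ∣-refl))
  where
  identity : ∀ a b t A B → (a + (b + t) * A) - (a + b * B) ≡ b * (A - B) + A * t
  identity = solve-∀

-- For g = a + x h, the remainder of g at b is b times that of h plus t (h(b + t) − h(b)).
∣-taylor-remainder : ∀ {d} g b t → All (d ∣_) g →
  d * t * t ∣ eval g (b + t) - eval g b - t * eval (deriv g) b
∣-taylor-remainder []       b t [] = ∣-≡ (identity t) (_ ∣0)
  where
  identity : ∀ t → + 0 - + 0 - t * + 0 ≡ 0ℤ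
  identity = solve-∀
∣-taylor-remainder (a ∷ as) b t (d∣a ∷ d∣as) rewrite eval-deriv-∷ a as b =
  ∣-≡ (identity a b t (eval as (b + t)) (eval as b) (eval (deriv as) b))
    (∣m∣n⇒∣m+n (∣n⇒∣m*n b (∣-taylor-remainder as b t d∣as))
               (∣-* (∣-eval-difference as b t d∣as) ∣-refl))
  where
  identity : ∀ a b t A B C → (a + (b + t) * A) - (a + b * B) - t * (B + b * C)
                           ≡ b * (A - B - t * C) + (A - B) * t
  identity = solve-∀

min∞-≤ʳ : ∀ a b → min∞ a b ≤ b
min∞-≤ʳ (just a) b = ℕ.m⊓n≤n a b
min∞-≤ʳ nothing  b = ℕ.≤-refl

2*e+k≡2*h⇒Even : ∀ e k h → 2 *ℕ e +ℕ k ≡ 2 *ℕ h → Even k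
2*e+k≡2*h⇒Even e k h eq = h ∸ e , (begin
  k                     ≡⟨ sym (ℕ.m+n∸m≡n (2 *ℕ e) k) ⟩
  2 *ℕ e +ℕ k ∸ 2 *ℕ e  ≡⟨ cong (_∸ 2 *ℕ e) eq ⟩
  2 *ℕ h ∸ 2 *ℕ e       ≡⟨ sym (ℕ.*-distribˡ-∸ 2 h e) ⟩
  2 *ℕ (h ∸ e)          ∎)
  where open ≡-Reasoning

Even⇒¬Odd : ∀ {k} → Even k → ¬ Odd k
Even⇒¬Odd (h , k≡2h) (h′ , k≡1+2h′) = ℕ.even≢odd h h′ (trans (sym k≡2h) k≡1+2h′)

module PrimePower (p : ℕ) where

  p^_ : ℕ → ℤ
  p^ a = + (p ^ a)

  p^-+ : ∀ a b → p^ (a +ℕ b) ≡ p^ a * p^ b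
  p^-+ a b = trans (cong +_ (ℕ.^-distribˡ-+-* p a b)) (ℤ.pos-* (p ^ a) (p ^ b))

  p^-suc : ∀ a → p^ suc a ≡ + p * p^ a
  p^-suc a = ℤ.pos-* p (p ^ a)

  p^-suc-* : ∀ a v → p^ suc a * v ≡ + p * (p^ a * v)
  p^-suc-* a v = trans (cong (_* v) (p^-suc a)) (ℤ.*-assoc (+ p) (p^ a) v)

  p∣p^suc : ∀ a → + p ∣ p^ suc a
  p∣p^suc a = divides (p^ a) (trans (p^-suc a) (ℤ.*-comm (+ p) (p^ a)))

  p^-mono-∣ : ∀ {a b} → a ≤ b → p^ a ∣ p^ b
  p^-mono-∣ {a} {b} a≤b =
    divides (p^ (b ∸ a)) (trans (cong p^_ (sym (ℕ.m∸n+n≡m a≤b))) (p^-+ (b ∸ a) a))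

  digit-≡-mod : (x : ℤₚ p) (n r : ℕ) → p^ n ∣ digit x (r +ℕ n) - digit x n
  digit-≡-mod x n zero    = ∣-≡ (ℤ.+-inverseʳ (digit x n)) (_ ∣0)
  digit-≡-mod x n (suc r) =
    ∣-≡ (telescope (digit x (suc r +ℕ n)) (digit x (r +ℕ n)) (digit x n))
      (∣m∣n⇒∣m+n (∣-trans (p^-mono-∣ (ℕ.m≤n+m n r))
                          (∣ᵤ⇒∣ {p^ (r +ℕ n)} {digit x (suc r +ℕ n) - digit x (r +ℕ n)} (coh x (r +ℕ n))))
                 (digit-≡-mod x n r))

  p^-+-2* : ∀ c n → p^ (c +ℕ 2 *ℕ n) ≡ p^ c * p^ n * p^ n
  p^-+-2* c n = begin
    p^ (c +ℕ 2 *ℕ n)           ≡⟨ p^-+ c (2 *ℕ n) ⟩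
    p^ c * p^ (n +ℕ (n +ℕ 0))  ≡⟨ cong (λ k → p^ c * p^ (n +ℕ k)) (ℕ.+-identityʳ n) ⟩
    p^ c * p^ (n +ℕ n)         ≡⟨ cong (p^ c *_) (p^-+ n n) ⟩
    p^ c * (p^ n * p^ n)       ≡⟨ sym (ℤ.*-assoc (p^ c) (p^ n) (p^ n)) ⟩
    p^ c * p^ n * p^ n         ∎
    where open ≡-Reasoning

  ∣*-Val∞ : ∀ {D} m n b t → Val∞ p D m → p^ n ∣ t → p^ min∞ (m +∞ n) b ∣ t * D
  ∣*-Val∞ nothing n b t D≡0 _ rewrite D≡0 = ∣-≡ (ℤ.*-zeroʳ t) (_ ∣0)
  ∣*-Val∞ {D} (just m) n b t (p^m∣D , _) p^n∣t = begin
    p^ ((m +ℕ n) ℕ.⊓ b)  ∣⟨ p^-mono-∣ (ℕ.≤-trans (ℕ.m⊓n≤m (m +ℕ n) b) (ℕ.≤-reflexive (ℕ.+-comm m n))) ⟩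
    p^ (n +ℕ m)          ≡⟨ p^-+ n m ⟩
    p^ n * p^ m          ∣⟨ ∣-* p^n∣t (∣ᵤ⇒∣ {p^ m} {D} p^m∣D) ⟩
    t * D                ∎
    where open ∣-Reasoning

  eval-≡-mod : ∀ {c n} g x0 t m → All (p^ c ∣_) g → Val∞ p (eval (deriv g) x0) m → p^ n ∣ t →
    p^ min∞ (m +∞ n) (c +ℕ 2 *ℕ n) ∣ eval g (x0 + t) - eval g x0
  eval-≡-mod {c} {n} g x0 t m p^c∣g val p^n∣t =
    ∣-≡ (identity (eval g (x0 + t)) (eval g x0) (t * eval (deriv g) x0))
      (∣m∣n⇒∣m+n remainder (∣*-Val∞ m n (c +ℕ 2 *ℕ n) t val p^n∣t))
    where
    identity : ∀ a b c → a - b ≡ (a - b - c) + c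
    identity = solve-∀
    remainder : p^ min∞ (m +∞ n) (c +ℕ 2 *ℕ n) ∣ eval g (x0 + t) - eval g x0 - t * eval (deriv g) x0
    remainder = begin
      p^ min∞ (m +∞ n) (c +ℕ 2 *ℕ n)  ∣⟨ p^-mono-∣ (min∞-≤ʳ (m +∞ n) _) ⟩
      p^ (c +ℕ 2 *ℕ n)                ≡⟨ p^-+-2* c n ⟩
      p^ c * p^ n * p^ n              ∣⟨ ∣-* (∣-* (∣-refl {p^ c}) p^n∣t) p^n∣t ⟩
      p^ c * t * t                    ∣⟨ ∣-taylor-remainder g x0 t p^c∣g ⟩
      eval g (x0 + t) - eval g x0 - t * eval (deriv g) x0 ∎
      where open ∣-Reasoning

  SquareInQp-≡-mod : ∀ {y a} n L → (∀ r → p^ L ∣ y (r +ℕ n) - a) → SquareInQp p y →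
    ∃₂ λ e z → p^ (2 *ℕ e +ℕ L) ∣ p^ (2 *ℕ e) * a - z * z
  SquareInQp-≡-mod {y} {a} n L y≡a (e , z , square) =
    e , zⱼ , ∣-≡ (identity (p^ (2 *ℕ e)) a (y j) zⱼ) (∣m∣n⇒∣m-n approximation shift)
    where
    j : ℕ
    j = (2 *ℕ e +ℕ L) +ℕ n
    zⱼ : ℤ
    zⱼ = digit z j
    identity : ∀ A a y z → A * a - z * z ≡ (A * y - z * z) - A * (y - a)
    identity = solve-∀
    approximation : p^ (2 *ℕ e +ℕ L) ∣ p^ (2 *ℕ e) * y j - zⱼ * zⱼ
    approximation = ∣-trans (p^-mono-∣ (ℕ.m≤m+n (2 *ℕ e +ℕ L) n))
      (∣ᵤ⇒∣ {p^ j} {p^ (2 *ℕ e) * y j - zⱼ * zⱼ} (square j))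
    shift : p^ (2 *ℕ e +ℕ L) ∣ p^ (2 *ℕ e) * (y j - a)
    shift = subst (_∣ p^ (2 *ℕ e) * (y j - a)) (sym (p^-+ (2 *ℕ e) L))
      (∣-* (∣-refl {p^ (2 *ℕ e)}) (y≡a (2 *ℕ e +ℕ L)))

  evalₚ-≡-mod : ∀ {c n} g (x : ℤₚ p) x0 m → All (p^ c ∣_) g → Val∞ p (eval (deriv g) x0) m →
    InCoset x x0 n → ∀ r → p^ min∞ (m +∞ n) (c +ℕ 2 *ℕ n) ∣ evalₚ g x (r +ℕ n) - eval g x0
  evalₚ-≡-mod {c} {n} g x x0 m p^c∣g val x∈coset r =
    subst (λ y → _ ∣ eval g y - eval g x0) (identity x0 xⱼ)
      (eval-≡-mod {c} g x0 (xⱼ - x0) m p^c∣g val p^n∣xⱼ-x0)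
    where
    xⱼ : ℤ
    xⱼ = digit x (r +ℕ n)
    identity : ∀ a b → a + (b - a) ≡ b
    identity = solve-∀
    p^n∣xⱼ-x0 : p^ n ∣ xⱼ - x0
    p^n∣xⱼ-x0 = ∣-≡ (telescope xⱼ (digit x n) x0)
      (∣m∣n⇒∣m+n (digit-≡-mod x n r) (∣ᵤ⇒∣ {p^ n} {digit x n - x0} x∈coset))

  ValP⇒unit : ∀ {a k} → ValP p a k → Σ ℤ λ u → a ≡ p^ k * u × ¬ + p ∣ u
  ValP⇒unit {a} {k} (p^k∣a , p^k+1∤a) with ∣ᵤ⇒∣ {p^ k} {a} p^k∣a
  ... | divides u a≡u*p^k = u , trans a≡u*p^k (ℤ.*-comm u (p^ k)) , p∤u
    where
    p∤u : ¬ + p ∣ u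
    p∤u (divides q u≡q*p) = p^k+1∤a (∣⇒∣ᵤ {p^ suc k} {a} (divides q (begin
      a                  ≡⟨ a≡u*p^k ⟩
      u * p^ k           ≡⟨ cong (_* p^ k) u≡q*p ⟩
      q * + p * p^ k     ≡⟨ ℤ.*-assoc q (+ p) (p^ k) ⟩
      q * (+ p * p^ k)   ≡⟨ cong (q *_) (sym (p^-suc k)) ⟩
      q * p^ suc k       ∎)))
      where open ≡-Reasoning

  module _ (p-prime : Prime p) where

    instance
      p≢0 : NonZero p
      p≢0 = prime⇒nonZero p-prime

    p∣z*z⇒p∣z : ∀ z → + p ∣ z * z → + p ∣ z
    p∣z*z⇒p∣z z p∣z*z
      with euclidsLemma ∣ z ∣ ∣ z ∣ p-prime (subst (p ∣ℕ_) (ℤ.abs-* z z) (∣⇒∣ᵤ p∣z*z))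
    ... | inj₁ p∣z = ∣ᵤ⇒∣ p∣z
    ... | inj₂ p∣z = ∣ᵤ⇒∣ p∣z

    square≡p*w⇒p*square≡w : ∀ z w → z * z ≡ + p * w → Σ ℤ λ q → + p * (q * q) ≡ w
    square≡p*w⇒p*square≡w z w z*z≡p*w
      with p∣z*z⇒p∣z z (divides w (trans z*z≡p*w (ℤ.*-comm (+ p) w)))
    ... | divides q refl = q , ℤ.*-cancelˡ-≡ (+ p) _ _ (trans (identity (+ p) q) z*z≡p*w)
      where
      identity : ∀ p q → p * (p * (q * q)) ≡ q * p * (q * p)
      identity = solve-∀

    -- p ∣ z² gives p² ∣ z², so the exponent of p drops by two until it is 0 or 1.
    square≡p^*unit : ∀ K z v → z * z ≡ p^ K * v → ¬ + p ∣ v →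
      ∃₂ λ h w → K ≡ 2 *ℕ h × w * w ≡ v
    square≡p^*unit zero z v z*z≡ _ = 0 , z , refl , trans z*z≡ (ℤ.*-identityˡ v)
    square≡p^*unit (suc zero) z v z*z≡ p∤v
      with square≡p*w⇒p*square≡w z (p^ 0 * v) (trans z*z≡ (p^-suc-* 0 v))
    ... | q , p*q*q≡1*v = ⊥-elim (p∤v (divides (q * q) (begin
      v              ≡⟨ sym (trans p*q*q≡1*v (ℤ.*-identityˡ v)) ⟩
      + p * (q * q)  ≡⟨ ℤ.*-comm (+ p) (q * q) ⟩
      q * q * + p    ∎)))
      where open ≡-Reasoning
    square≡p^*unit (suc (suc K)) z v z*z≡ p∤v
      with square≡p*w⇒p*square≡w z (p^ suc K * v) (trans z*z≡ (p^-suc-* (suc K) v))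
    ... | q , p*q*q≡
      with square≡p^*unit K q v (ℤ.*-cancelˡ-≡ (+ p) _ _ (trans p*q*q≡ (p^-suc-* K v))) p∤v
    ... | h , w , K≡2h , w*w≡v = suc h , w , trans (cong (2 +ℕ_) K≡2h) (sym (ℕ.*-suc 2 h)) , w*w≡v

    square-mod-p^ : ∀ {u z} K L → K < L → ¬ + p ∣ u → p^ L ∣ p^ K * u - z * z →
      ∃₂ λ h w → K ≡ 2 *ℕ h × p^ (L ∸ K) ∣ u - w * w
    square-mod-p^ {u} {z} K L K<L p∤u p^L∣
      with L ∸ K | ℕ.m+[n∸m]≡n (ℕ.<⇒≤ K<L) | ℕ.m<n⇒0<n∸m K<L | p^L∣
    ... | suc d | refl | _ | divides q ≡q*p^L
      with square≡p^*unit K z u′ z*z≡p^K*u′ p∤u′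
      where
      D u′ : ℤ
      D = p^ suc d
      u′ = u - q * D
      z*z≡p^K*u′ : z * z ≡ p^ K * u′
      z*z≡p^K*u′ = begin
        z * z                          ≡⟨ identity₁ (p^ K * u) (z * z) ⟩
        p^ K * u - (p^ K * u - z * z)  ≡⟨ cong (p^ K * u -_) (trans ≡q*p^L (cong (q *_) (p^-+ K (suc d)))) ⟩
        p^ K * u - q * (p^ K * D)      ≡⟨ identity₂ (p^ K) u q D ⟩
        p^ K * u′                      ∎
        where
        open ≡-Reasoning
        identity₁ : ∀ a b → b ≡ a - (a - b)
        identity₁ = solve-∀
        identity₂ : ∀ A u q D → A * u - q * (A * D) ≡ A * (u - q * D)
        identity₂ = solve-∀
      p∤u′ : ¬ + p ∣ u′
      p∤u′ p∣u′ = p∤u (∣-≡ (identity u q D) (∣m∣n⇒∣m+n p∣u′ (∣n⇒∣m*n q (p∣p^suc d))))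
        where
        identity : ∀ u q D → u ≡ (u - q * D) + q * D
        identity = solve-∀
    ... | h , w , K≡2h , w*w≡u′ = h , w , K≡2h , divides q (begin
      u - w * w                 ≡⟨ cong (u -_) w*w≡u′ ⟩
      u - (u - q * p^ suc d)    ≡⟨ identity u (q * p^ suc d) ⟩
      q * p^ suc d              ∎)
      where
      open ≡-Reasoning
      identity : ∀ a b → a - (a - b) ≡ b
      identity = solve-∀

    ValP-square-mod : ∀ {a k} e L z → ValP p a k → k < L →
      p^ (2 *ℕ e +ℕ L) ∣ p^ (2 *ℕ e) * a - z * z →
      Even k × Σ ℤ λ u → a ≡ p^ k * u × SquareMod p (L ∸ k) u
    ValP-square-mod {a} {k} e L z val k<L p^∣ with ValP⇒unit {a} {k} val
    ... | u , a≡p^k*u , p∤u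
      with square-mod-p^ {u} {z} (2 *ℕ e +ℕ k) (2 *ℕ e +ℕ L) (ℕ.+-monoʳ-< (2 *ℕ e) k<L) p∤u
             (∣-≡ rescale p^∣)
      where
      rescale : p^ (2 *ℕ e +ℕ k) * u - z * z ≡ p^ (2 *ℕ e) * a - z * z
      rescale = cong (_- z * z) (begin
        p^ (2 *ℕ e +ℕ k) * u     ≡⟨ cong (_* u) (p^-+ (2 *ℕ e) k) ⟩
        p^ (2 *ℕ e) * p^ k * u   ≡⟨ ℤ.*-assoc (p^ (2 *ℕ e)) (p^ k) u ⟩
        p^ (2 *ℕ e) * (p^ k * u) ≡⟨ cong (p^ (2 *ℕ e) *_) (sym a≡p^k*u) ⟩
        p^ (2 *ℕ e) * a          ∎)
        where open ≡-Reasoning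
    ... | h , w , 2e+k≡2h , p^∣u-w*w =
      2*e+k≡2*h⇒Even e k h 2e+k≡2h , u , a≡p^k*u , w ,
      ∣⇒∣ᵤ {p^ (L ∸ k)} {u - w * w}
        (subst (λ d → p^ d ∣ u - w * w) (ℕ.[m+n]∸[m+o]≡n∸o (2 *ℕ e) L k) p^∣u-w*w)

open PrimePower using (evalₚ-≡-mod; SquareInQp-≡-mod; ValP-square-mod)

lemma3p4 : (p : ℕ) → Prime p → (g : Poly) → (x0 : ℤ) → (n : ℕ) → n ≥ 1 →
    (c : ℕ) → MinCoeffVal p g c →
    (m : Maybe ℕ) → Val∞ p (eval (deriv g) x0) m →
    (λ' : ℕ) → λ' ≡ min∞ (m +∞ n) (c +ℕ 2 *ℕ n) →
    (k : ℕ) → ValP p (eval g x0) k →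
    k < λ' →
    (Odd k ⊎ (Even k × (∀ (u : ℤ) → eval g x0 ≡ + (p ^ k) * u → ¬ SquareMod p (λ' ∸ k) u))) →
    ∀ (x : ℤₚ p) → InCoset x x0 n → ¬ SquareInQp p (evalₚ g x)
-- Neither n ≥ 1 nor the fact that c is attained by some coefficient is needed.
lemma3p4 p p-prime g x0 n _ c (p^c∣g , _) m val λ' refl k val-k k<λ parity x x∈coset square =
  let e , z , congruence =
        SquareInQp-≡-mod p n λ' (evalₚ-≡-mod p {c} g x x0 m p^c∣g′ val x∈coset) square
      even , u , g≡p^k*u , u-square = ValP-square-mod p p-prime e λ' z val-k k<λ congruence
  in [ Even⇒¬Odd even , (λ (_ , u-nonsquare) → u-nonsquare u g≡p^k*u u-square) ]′ parity
  where
  p^c∣g′ : All (+ (p ^ c) ∣_) g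
  p^c∣g′ = All.map (λ {a} → ∣ᵤ⇒∣ {+ (p ^ c)} {a}) p^c∣g
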